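{- Let $\pi\in S_n$ and $i\in[n-1]$, and suppose $i+1$ appears to the left of $i$ in $\pi$. Then $\widetilde t_i$ restricts to an injection from $s^{ -1}(\pi)$ to $s^{ -1}(\widetilde t_i(\pi))$. Moreover, if there exists an entry $a$ such that $i+1,a,i$ form a $231$ pattern in $\pi$, then $\widetilde t_i:s^{ -1}(\pi)\to s^{ -1}(\widetilde t_i(\pi))$ is a bijection.
   Context: $S_n$ is the set of permutations of $[n]$ in one-line notation. The stack-sorting map $s$: $s$ of the empty permutation is empty, and if $\pi=LmR$ with $m$ the largest entry, then $s(\pi)=s(L)s(R)m$; $s^{ -1}(\pi)=\{\tau\in S_n:s(\tau)=\pi\}$. For $\tau\in S_n$ and $i\in[n-1]$, $\widetilde t_i(\tau)$ is the permutation obtained by swapping the positions of the entries $i$ and $i+1$ if $i+1$ appears to the left of $i$ in $\tau$, and $\widetilde t_i(\tau)=\tau$ otherwise. Three entries $b,c,a$ form a $231$ pattern in $\pi$ if they appear in this left-to-right order and $a<b<c$. -}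

module Defs where

open import Data.Nat using (ℕ; zero; suc; _⊔_; _≟_; _≡ᵇ_; _<_; _≤_)
open import Data.Bool using (Bool; true; false; if_then_else_)
open import Data.List using (List; []; _∷_; _++_; length; map; upTo; foldr; span; drop)
open import Data.List.Relation.Binary.Permutation.Propositional using (_↭_)
open import Data.List.Relation.Binary.Sublist.Propositional using (_⊆_)
open import Data.Product using (_×_; _,_; ∃)
open import Relation.Nullary using (¬?)
open import Relation.Binary.PropositionalEquality using (_≡_)

-- A permutation of [n] in one-line notation: a list that is a rearrangement
-- of 1, 2, ..., n.
IsPerm : ℕ → List ℕ → Set
IsPerm n π = π ↭ map suc (upTo n)

maxL : List ℕ → ℕ
maxL = foldr _⊔_ 0

-- Stack-sorting map, s(LmR) = s(L) s(R) m with m the largest entry.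
-- Defined with fuel; the fuel (length of the list) always suffices.
sFuel : ℕ → List ℕ → List ℕ
sFuel zero    _        = []
sFuel (suc k) []       = []
sFuel (suc k) (x ∷ xs) with span (λ y → ¬? (y ≟ maxL (x ∷ xs))) (x ∷ xs)
... | (L , rest) = sFuel k L ++ sFuel k (drop 1 rest) ++ (maxL (x ∷ xs) ∷ [])

s : List ℕ → List ℕ
s π = sFuel (length π) π

meetsFirst : ℕ → ℕ → List ℕ → Bool
meetsFirst b a []       = false
meetsFirst b a (x ∷ xs) =
  if x ≡ᵇ b then true else (if x ≡ᵇ a then false else meetsFirst b a xs)

swapVal : ℕ → ℕ → ℕ
swapVal i x = if x ≡ᵇ i then suc i else (if x ≡ᵇ suc i then i else x)

tt : ℕ → List ℕ → List ℕ
tt i τ = if meetsFirst (suc i) i τ then map (swapVal i) τ else τ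

LeftOf : ℕ → ℕ → List ℕ → Set
LeftOf b a π = (b ∷ a ∷ []) ⊆ π

Is231 : ℕ → ℕ → ℕ → List ℕ → Set
Is231 b c a π = (b ∷ c ∷ a ∷ []) ⊆ π × a < b × b < c

module Submission where

-- Write f for the value swap i ↔ i+1 (swapVal i), so that
-- t̃ᵢ τ = map f τ whenever i+1 is left of i in τ.
-- Three facts about this relation give the theorem:
--   * s permutes its input and never reverses an increasing pair, so in
--     every preimage τ of π the entry i+1 is left of i and t̃ᵢ τ = map f τ;
--   * s commutes with map f unless the output has a "low factor"
--     i w (i+1) with all of w at most i+1 (then i, i+1 would be separated
--     in the recursion by a maximum i+1 that f would demote);
--   * π (i+1 left of i) has no low factor, and neither has map f π when π
--     contains a 231 pattern (i+1, c, i), since c > i+1 lies between i, i+1.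
-- Part 1 is the commutation, part 2 the injectivity of map f, and part 3
-- takes τ = map f σ for a preimage σ of t̃ᵢ π.

open import Defs
open import Data.Nat using (ℕ; suc; _≤_; _<_)
open import Data.List using (List)
open import Data.Product using (_×_; ∃)
open import Relation.Binary.PropositionalEquality using (_≡_)

open import Data.Nat using (zero; _+_; _⊔_; _≟_; _≡ᵇ_; _<?_; z≤n; s≤s)
open import Data.Nat.Properties
  using (≤-refl; ≤-trans; ≤-pred; <⇒≤; <⇒≢; ≤∧≢⇒<; ≮⇒≥; n<1+n; m<n⇒m<1+n;
         <-trans; <-≤-trans; <-irrefl; m≤n⇒m<n∨m≡n; suc-injective; +-suc;
         m≤m+n; m≤n+m; ⊔-lub; m≥n⇒m⊔n≡m; m≤n⇒m⊔n≡n)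
open import Data.Bool using (true; false)
open import Data.List using ([]; _∷_; _++_; length; map; upTo; span; drop)
open import Data.List.Properties using (map-++; length-++; ++-assoc; map-injective)
open import Data.List.Membership.Propositional using (_∈_)
open import Data.List.Membership.Propositional.Properties
  using (∈-++⁺ˡ; ∈-++⁺ʳ; ∈-++⁻; ∈-∃++)
open import Data.List.Relation.Unary.Any using (here; there)
open import Data.List.Relation.Unary.All as All using (All; []; _∷_)
import Data.List.Relation.Unary.All.Properties as AllP
open import Data.List.Relation.Unary.AllPairs using (_∷_)
open import Data.List.Relation.Unary.Unique.Propositional using (Unique)
import Data.List.Relation.Unary.Unique.Propositional.Properties as UniqueP
import Data.List.Relation.Binary.Permutation.Setoid.Properties as PermSetoid
open import Data.List.Relation.Binary.Permutation.Propositional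
  using (_↭_; ↭⇒↭ₛ; ↭-refl; ↭-sym; ↭-trans)
import Data.List.Relation.Binary.Permutation.Propositional.Properties as Perm
open import Data.List.Relation.Binary.Sublist.Propositional
  using (_⊆_; _∷_; _∷ʳ_; from∈; to∈; lookup)
import Data.List.Relation.Binary.Sublist.Propositional.Properties as Sublist
open import Data.Product using (_,_; proj₂; ∃-syntax)
open import Data.Sum as Sum using (_⊎_; inj₁; inj₂)
open import Data.Empty using (⊥-elim)
open import Function using (_∘_)
open import Relation.Nullary using (¬_; ¬?; yes; no)
open import Relation.Nullary.Decidable using (dec-true; dec-false)
open import Relation.Binary.PropositionalEquality
  using (refl; sym; trans; cong; cong₂; subst; subst₂; _≢_; setoid; module ≡-Reasoning)

private
  variable
    a b c i k x y M : ℕ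
    l o u w v xs ys L R π σ τ τ′ : List ℕ

≡ᵇ-refl : ∀ x → (x ≡ᵇ x) ≡ true
≡ᵇ-refl x = dec-true (x ≟ x) refl

≡ᵇ-≢ : x ≢ y → (x ≡ᵇ y) ≡ false
≡ᵇ-≢ {x} {y} = dec-false (x ≟ y)

unique-resp-↭ : xs ↭ ys → Unique xs → Unique ys
unique-resp-↭ p = PermSetoid.Unique-resp-↭ (setoid ℕ) (↭⇒↭ₛ p)

perm-unique : ∀ n → IsPerm n l → Unique l
perm-unique n p = unique-resp-↭ (↭-sym p) (UniqueP.map⁺ suc-injective (UniqueP.upTo⁺ n))

head-≢ : Unique (x ∷ xs) → y ∈ xs → x ≢ y
head-≢ (x≢ ∷ _) = All.lookup x≢

leftOf-total : a ∈ l → b ∈ l → a ≢ b → LeftOf a b l ⊎ LeftOf b a l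
leftOf-total (here refl) (here refl) a≢b = ⊥-elim (a≢b refl)
leftOf-total (here refl) (there b∈) _    = inj₁ (refl ∷ from∈ b∈)
leftOf-total (there a∈) (here refl) _    = inj₂ (refl ∷ from∈ a∈)
leftOf-total {l = x ∷ _} (there a∈) (there b∈) a≢b =
  Sum.map (x ∷ʳ_) (x ∷ʳ_) (leftOf-total a∈ b∈ a≢b)

leftOf-asym : Unique l → LeftOf a b l → ¬ LeftOf b a l
leftOf-asym (_ ∷ u) (_ ∷ʳ p)  (_ ∷ʳ q)  = leftOf-asym u p q
leftOf-asym u       (refl ∷ _) (_ ∷ʳ q)  = head-≢ u (lookup q (there (here refl))) refl
leftOf-asym u       (_ ∷ʳ p)  (refl ∷ _) = head-≢ u (lookup p (there (here refl))) refl
leftOf-asym u       (refl ∷ p) (refl ∷ _) = head-≢ u (to∈ p) refl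

leftOf-++⁻ : LeftOf a b (xs ++ ys) → LeftOf a b xs ⊎ (a ∈ xs × b ∈ ys) ⊎ LeftOf a b ys
leftOf-++⁻ {xs = []} p = inj₂ (inj₂ p)
leftOf-++⁻ {xs = x ∷ xs} (_ ∷ʳ p) =
  Sum.map (x ∷ʳ_) (Sum.map₁ (λ (a∈ , b∈) → there a∈ , b∈)) (leftOf-++⁻ p)
leftOf-++⁻ {xs = x ∷ xs} (refl ∷ p) with ∈-++⁻ xs (to∈ p)
... | inj₁ b∈xs = inj₁ (refl ∷ from∈ b∈xs)
... | inj₂ b∈ys = inj₂ (inj₁ (here refl , b∈ys))

leftOf-++⁺ : a ∈ xs → b ∈ ys → LeftOf a b (xs ++ ys)
leftOf-++⁺ {xs = _ ∷ xs} (here refl) b∈ = refl ∷ from∈ (∈-++⁺ʳ xs b∈)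
leftOf-++⁺ {xs = x ∷ _}  (there a∈)  b∈ = x ∷ʳ leftOf-++⁺ a∈ b∈

meetsFirst-leftOf : Unique l → LeftOf b a l → meetsFirst b a l ≡ true
meetsFirst-leftOf {b = b} _ (refl ∷ _) rewrite ≡ᵇ-refl b = refl
meetsFirst-leftOf u@(_ ∷ u′) (_ ∷ʳ p)
  rewrite ≡ᵇ-≢ (head-≢ u (lookup p (here refl)))
        | ≡ᵇ-≢ (head-≢ u (lookup p (there (here refl)))) = meetsFirst-leftOf u′ p

tt-leftOf : Unique l → LeftOf (suc i) i l → tt i l ≡ map (swapVal i) l
tt-leftOf u p rewrite meetsFirst-leftOf u p = refl

swap-i : swapVal i i ≡ suc i
swap-i {i} rewrite ≡ᵇ-refl i = refl

swap-suc : swapVal i (suc i) ≡ i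
swap-suc {i} rewrite ≡ᵇ-≢ (<⇒≢ (n<1+n i) ∘ sym) | ≡ᵇ-refl i = refl

swap-other : x ≢ i → x ≢ suc i → swapVal i x ≡ x
swap-other p q rewrite ≡ᵇ-≢ p | ≡ᵇ-≢ q = refl

data SwapCase (i x : ℕ) : ℕ → Set where
  lower : x ≡ i → SwapCase i x (suc i)
  upper : x ≡ suc i → SwapCase i x i
  fixed : x ≢ i → x ≢ suc i → SwapCase i x x

swap-case : ∀ i x → SwapCase i x (swapVal i x)
swap-case i x with x ≟ i | x ≟ suc i
... | yes refl | _        = subst (SwapCase i x) (sym swap-i) (lower refl)
... | no _     | yes refl = subst (SwapCase i x) (sym swap-suc) (upper refl)
... | no p     | no q     = subst (SwapCase i x) (sym (swap-other p q)) (fixed p q)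

swap-involutive : ∀ i x → swapVal i (swapVal i x) ≡ x
swap-involutive i x with swapVal i x | swap-case i x
... | _ | lower refl = swap-suc
... | _ | upper refl = swap-i
... | _ | fixed p q  = swap-other p q

swap-injective : swapVal i x ≡ swapVal i y → x ≡ y
swap-injective {i} {x} {y} e =
  trans (sym (swap-involutive i x)) (trans (cong (swapVal i) e) (swap-involutive i y))

map-swap-involutive : ∀ i l → map (swapVal i) (map (swapVal i) l) ≡ l
map-swap-involutive i []      = refl
map-swap-involutive i (x ∷ l) = cong₂ _∷_ (swap-involutive i x) (map-swap-involutive i l)

swap-< : x < y → ¬ (x ≡ i × y ≡ suc i) → swapVal i x < swapVal i y
swap-< {x} {y} {i} x<y excl
  with swapVal i x | swap-case i x | swapVal i y | swap-case i y
... | _ | lower refl | _ | lower refl = ⊥-elim (<-irrefl refl x<y)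
... | _ | lower refl | _ | upper refl = ⊥-elim (excl (refl , refl))
... | _ | lower refl | _ | fixed _ q  = ≤∧≢⇒< x<y (q ∘ sym)
... | _ | upper refl | _ | lower refl = ⊥-elim (<-irrefl refl (<-trans x<y (n<1+n i)))
... | _ | upper refl | _ | upper refl = ⊥-elim (<-irrefl refl x<y)
... | _ | upper refl | _ | fixed _ _  = <-trans (n<1+n i) x<y
... | _ | fixed _ _  | _ | lower refl = m<n⇒m<1+n x<y
... | _ | fixed p _  | _ | upper refl = ≤∧≢⇒< (≤-pred x<y) p
... | _ | fixed _ _  | _ | fixed _ _  = x<y

swap-≤ : x ≤ y → ¬ (x ≡ i × y ≡ suc i) → swapVal i x ≤ swapVal i y
swap-≤ {i = i} x≤y excl with m≤n⇒m<n∨m≡n x≤y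
... | inj₁ x<y  = <⇒≤ (swap-< x<y excl)
... | inj₂ refl = ≤-refl

maxL-lub : All (_≤ M) l → maxL l ≤ M
maxL-lub []       = z≤n
maxL-lub (p ∷ ps) = ⊔-lub p (maxL-lub ps)

maxL-cut : All (_≤ M) L → All (_≤ M) R → maxL (L ++ M ∷ R) ≡ M
maxL-cut []       R≤ = m≥n⇒m⊔n≡m (maxL-lub R≤)
maxL-cut (p ∷ ps) R≤ = trans (cong (_ ⊔_) (maxL-cut ps R≤)) (m≤n⇒m⊔n≡n p)

span-cut : All (_< M) L → span (λ y → ¬? (y ≟ M)) (L ++ M ∷ R) ≡ (L , M ∷ R)
span-cut {M} [] rewrite ≡ᵇ-refl M = refl
span-cut {L = x ∷ _} (p ∷ ps) rewrite ≡ᵇ-≢ (<⇒≢ p) =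
  cong (λ (L , rest) → x ∷ L , rest) (span-cut ps)

sFuel-unfold : ∀ k x xs → maxL (x ∷ xs) ≡ M →
  span (λ y → ¬? (y ≟ M)) (x ∷ xs) ≡ (L , M ∷ R) →
  sFuel (suc k) (x ∷ xs) ≡ sFuel k L ++ sFuel k R ++ M ∷ []
sFuel-unfold k x xs refl e =
  cong (λ (L , rest) → sFuel k L ++ sFuel k (drop 1 rest) ++ maxL (x ∷ xs) ∷ []) e

-- s(L M R) = s(L) s(R) M, one level of the recursion (the two clauses only
-- expose that L ++ M ∷ R is a cons).
sFuel-cut : ∀ k → All (_< M) L → All (_≤ M) R →
  sFuel (suc k) (L ++ M ∷ R) ≡ sFuel k L ++ sFuel k R ++ M ∷ []
sFuel-cut {L = []}    k L< R≤ =
  sFuel-unfold k _ _ (maxL-cut (All.map <⇒≤ L<) R≤) (span-cut L<)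
sFuel-cut {L = _ ∷ _} k L< R≤ =
  sFuel-unfold k _ _ (maxL-cut (All.map <⇒≤ L<) R≤) (span-cut L<)

data StackSorts : List ℕ → List ℕ → Set where
  []  : StackSorts [] []
  cut : ∀ {L R oL oR} M → All (_< M) L → All (_≤ M) R →
        StackSorts L oL → StackSorts R oR →
        StackSorts (L ++ M ∷ R) (oL ++ oR ++ M ∷ [])

length-cut : ∀ L R → length (L ++ M ∷ R) ≡ suc (length L + length R)
length-cut L R = trans (length-++ L) (+-suc (length L) (length R))

sFuel-stackSorts : StackSorts l o → length l ≤ k → sFuel k l ≡ o
sFuel-stackSorts {k = zero}  [] _ = refl
sFuel-stackSorts {k = suc _} [] _ = refl
sFuel-stackSorts {k = zero} (cut {L} {R} _ _ _ _ _) h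
  with subst (_≤ 0) (length-cut L R) h
... | ()
sFuel-stackSorts {k = suc k} (cut {L} {R} M L< R≤ dL dR) h
  with subst (_≤ suc k) (length-cut L R) h
... | s≤s h′ = begin
  sFuel (suc k) (L ++ M ∷ R)        ≡⟨ sFuel-cut k L< R≤ ⟩
  sFuel k L ++ sFuel k R ++ M ∷ []  ≡⟨ cong₂ (λ oL oR → oL ++ oR ++ M ∷ [])
                                         (sFuel-stackSorts dL (≤-trans (m≤m+n _ _) h′))
                                         (sFuel-stackSorts dR (≤-trans (m≤n+m _ _) h′)) ⟩
  _                                 ∎
  where open ≡-Reasoning

stackSorts⇒s : StackSorts l o → s l ≡ o
stackSorts⇒s d = sFuel-stackSorts d ≤-refl

record MaxCut (l : List ℕ) : Set where
  constructor maxCut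
  field
    {left right} : List ℕ
    max          : ℕ
    left<        : All (_< max) left
    right≤       : All (_≤ max) right
    splits       : l ≡ left ++ max ∷ right

cutAtMax : ∀ x xs → MaxCut (x ∷ xs)
cutAtMax x [] = maxCut x [] [] refl
cutAtMax x (y ∷ ys) with cutAtMax y ys
... | maxCut {L} {R} M L< R≤ eq with x <? M
...   | yes x<M = maxCut M (x<M ∷ L<) R≤ (cong (x ∷_) eq)
...   | no  x≮M = maxCut x [] (subst (All (_≤ x)) (sym eq) below-x) refl
  where
  M≤x : M ≤ x
  M≤x = ≮⇒≥ x≮M
  below-x : All (_≤ x) (L ++ M ∷ R)
  below-x = AllP.++⁺ (All.map (λ p → ≤-trans (<⇒≤ p) M≤x) L<)
                     (M≤x ∷ All.map (λ p → ≤-trans p M≤x) R≤)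

stackSorts-exists : ∀ k l → length l ≤ k → ∃ (StackSorts l)
stackSorts-exists _       []       _       = [] , []
stackSorts-exists (suc k) (x ∷ xs) (s≤s h) with cutAtMax x xs
... | maxCut {L} {R} M L< R≤ eq =
  subst (∃ ∘ StackSorts) (sym eq)
    (_ , cut M L< R≤ (proj₂ (stackSorts-exists k L (≤-trans (m≤m+n _ _) parts≤k)))
                     (proj₂ (stackSorts-exists k R (≤-trans (m≤n+m _ _) parts≤k))))
  where
  parts≤k : length L + length R ≤ k
  parts≤k = subst (_≤ k) (suc-injective (trans (cong length eq) (length-cut L R))) h

s-stackSorts : ∀ l → StackSorts l (s l)
s-stackSorts l with stackSorts-exists (length l) l ≤-refl
... | _ , d = subst (StackSorts l) (sym (stackSorts⇒s d)) d

stackSorts-↭ : StackSorts l o → o ↭ l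
stackSorts-↭ []                        = ↭-refl
stackSorts-↭ (cut {R = R} M _ _ dL dR) =
  Perm.++⁺ (stackSorts-↭ dL)
           (↭-trans (Perm.++⁺ʳ (M ∷ []) (stackSorts-↭ dR)) (↭-sym (Perm.∷↭∷ʳ M R)))

s-↭ : ∀ l → s l ↭ l
s-↭ l = stackSorts-↭ (s-stackSorts l)

∈-stackSorts : StackSorts l o → x ∈ l → x ∈ o
∈-stackSorts d = Perm.∈-resp-↭ (↭-sym (stackSorts-↭ d))

-- Stack-sorting never reverses an increasing pair: if a < b and a is left
-- of b in l, then a is left of b in the output.  (At a cut, a cannot be the
-- maximum M, since b ≤ M; otherwise the order of s(L) s(R) M keeps a first.)
stackSorts-increasing : StackSorts l o → a < b → LeftOf a b l → LeftOf a b o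
stackSorts-increasing (cut {L} {R} {oL} {oR} M _ R≤ dL dR) a<b p with leftOf-++⁻ {xs = L} p
... | inj₁ inL                        = Sublist.++⁺ʳ _ (stackSorts-increasing dL a<b inL)
... | inj₂ (inj₁ (a∈L , here refl))  =
  leftOf-++⁺ (∈-stackSorts dL a∈L) (∈-++⁺ʳ oR (here refl))
... | inj₂ (inj₁ (a∈L , there b∈R))  =
  leftOf-++⁺ (∈-stackSorts dL a∈L) (∈-++⁺ˡ (∈-stackSorts dR b∈R))
... | inj₂ (inj₂ (refl ∷ q))         =
  ⊥-elim (<-irrefl refl (<-≤-trans a<b (All.lookup R≤ (to∈ q))))
... | inj₂ (inj₂ (_ ∷ʳ q))           =
  Sublist.++⁺ˡ oL (Sublist.++⁺ʳ (M ∷ []) (stackSorts-increasing dR a<b q))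

-- Low factors: o contains i, then later i+1, with every entry in between at
-- most i+1.  They are the only obstruction to commuting s with the swap.
LowFactor : ℕ → List ℕ → Set
LowFactor i o = ∃[ u ] ∃[ w ] ∃[ v ] o ≡ u ++ i ∷ w ++ suc i ∷ v × All (_≤ suc i) w

lowFactor-++ˡ : LowFactor i xs → LowFactor i (xs ++ ys)
lowFactor-++ˡ {i} {ys = ys} (u , w , v , refl , w≤) =
  u , w , v ++ ys , trans (++-assoc u _ ys) (cong (λ t → u ++ i ∷ t) (++-assoc w _ ys)) , w≤

lowFactor-++ʳ : LowFactor i ys → LowFactor i (xs ++ ys)
lowFactor-++ʳ {xs = xs} (u , w , v , refl , w≤) = xs ++ u , w , v , sym (++-assoc xs u _) , w≤

lowFactor-at-end : All (_≤ suc i) xs → i ∈ xs → LowFactor i (xs ++ suc i ∷ [])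
lowFactor-at-end {i} xs≤ i∈ with ∈-∃++ i∈
... | u , w , refl = u , w , [] , ++-assoc u (i ∷ w) _ , w≤
  where
  w≤ : All (_≤ suc i) w
  w≤ = All.tail (AllP.++⁻ʳ u xs≤)

-- Stack-sorting commutes with swapping the values i and i+1 as long as the
-- output has no low factor: then no recursion step has maximum i+1 with i
-- below it, so the swap keeps every cut at the same place.
stackSorts-swap : StackSorts l o → ¬ LowFactor i o →
  StackSorts (map (swapVal i) l) (map (swapVal i) o)
stackSorts-swap [] _ = []
stackSorts-swap {i = i} (cut {L} {R} {oL} {oR} M L< R≤ dL dR) noLow =
  subst₂ StackSorts (sym (map-++ f L (M ∷ R))) (sym map-out)
    (cut (f M) fL<fM fR≤fM (stackSorts-swap dL (noLow ∘ lowFactor-++ˡ))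
                           (stackSorts-swap dR (noLow ∘ lowFactor-++ʳ {xs = oL} ∘ lowFactor-++ˡ)))
  where
  f : ℕ → ℕ
  f = swapVal i
  map-out : map f (oL ++ oR ++ M ∷ []) ≡ map f oL ++ map f oR ++ f M ∷ []
  map-out = trans (map-++ f oL _) (cong (map f oL ++_) (map-++ f oR _))
  -- If M = i+1 had i below it, the output oL oR (i+1) would have a low factor.
  not-i-below : x ∈ L ++ R → ¬ (x ≡ i × M ≡ suc i)
  not-i-below x∈ (refl , refl) =
    noLow (subst (LowFactor i) (++-assoc oL oR _)
      (lowFactor-at-end (Perm.All-resp-↭ (↭-sym parts-↭) (AllP.++⁺ (All.map <⇒≤ L<) R≤))
                        (Perm.∈-resp-↭ (↭-sym parts-↭) x∈)))
    where
    parts-↭ : oL ++ oR ↭ L ++ R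
    parts-↭ = Perm.++⁺ (stackSorts-↭ dL) (stackSorts-↭ dR)
  fL<fM : All (_< f M) (map f L)
  fL<fM = AllP.map⁺ (All.tabulate λ x∈L →
            swap-< (All.lookup L< x∈L) (not-i-below (∈-++⁺ˡ x∈L)))
  fR≤fM : All (_≤ f M) (map f R)
  fR≤fM = AllP.map⁺ (All.tabulate λ x∈R →
            swap-≤ (All.lookup R≤ x∈R) (not-i-below (∈-++⁺ʳ L x∈R)))

s-swap : s l ≡ o → ¬ LowFactor i o → s (map (swapVal i) l) ≡ map (swapVal i) o
s-swap {l} refl noLow = stackSorts⇒s (stackSorts-swap (s-stackSorts l) noLow)

lowFactor-leftOf : LowFactor i o → LeftOf i (suc i) o
lowFactor-leftOf (u , w , _ , refl , _) = Sublist.++⁺ˡ u (refl ∷ from∈ (∈-++⁺ʳ w (here refl)))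

unique-++⁻ʳ : ∀ u → Unique (u ++ xs) → Unique xs
unique-++⁻ʳ []      uq       = uq
unique-++⁻ʳ (_ ∷ u) (_ ∷ uq) = unique-++⁻ʳ u uq

after-occurrence : Unique (u ++ x ∷ xs) → (x ∷ ys) ⊆ u ++ x ∷ xs → ys ⊆ xs
after-occurrence {u = []}    _        (refl ∷ p) = p
after-occurrence {u = []}    uq       (_ ∷ʳ p)   = ⊥-elim (head-≢ uq (lookup p (here refl)) refl)
after-occurrence {u = _ ∷ _} (_ ∷ uq) (_ ∷ʳ p)   = after-occurrence uq p
after-occurrence {u = _ ∷ u} uq       (refl ∷ _) =
  ⊥-elim (head-≢ uq (∈-++⁺ʳ u (here refl)) refl)

before-occurrence : Unique (w ++ y ∷ v) → LeftOf c y (w ++ y ∷ v) → c ≢ y → c ∈ w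
before-occurrence {w = []}    uq       (_ ∷ʳ p)   _   =
  ⊥-elim (head-≢ uq (lookup p (there (here refl))) refl)
before-occurrence {w = []}    _        (refl ∷ _) c≢y = ⊥-elim (c≢y refl)
before-occurrence {w = _ ∷ _} (_ ∷ uq) (_ ∷ʳ p)   c≢y = there (before-occurrence uq p c≢y)
before-occurrence {w = _ ∷ _} _        (refl ∷ _) _   = here refl

no-lowFactor-over : Unique o → (i ∷ c ∷ suc i ∷ []) ⊆ o → suc i < c → ¬ LowFactor i o
no-lowFactor-over {i = i} {c} uq p i+1<c (u , w , v , refl , w≤) =
  <-irrefl refl (<-≤-trans i+1<c (All.lookup w≤ c∈w))
  where
  unique-after-i : Unique (i ∷ w ++ suc i ∷ v) → Unique (w ++ suc i ∷ v)
  unique-after-i (_ ∷ uq′) = uq′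
  c∈w : c ∈ w
  c∈w = before-occurrence (unique-after-i (unique-++⁻ʳ u uq)) (after-occurrence uq p)
                          (<⇒≢ i+1<c ∘ sym)

swap-231 : Is231 (suc i) c i π → (i ∷ c ∷ suc i ∷ []) ⊆ map (swapVal i) π
swap-231 {i} {c} {π} (p , _ , i+1<c) =
  subst (_⊆ map (swapVal i) π) swapped (Sublist.map⁺ (swapVal i) p)
  where
  swapped : map (swapVal i) (suc i ∷ c ∷ i ∷ []) ≡ i ∷ c ∷ suc i ∷ []
  swapped = cong₂ _∷_ swap-suc
    (cong₂ _∷_ (swap-other (<⇒≢ (<-trans (n<1+n i) i+1<c) ∘ sym) (<⇒≢ i+1<c ∘ sym))
               (cong (_∷ []) swap-i))

-- If i+1 is left of i in π, the same holds in every preimage τ (s never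
-- reverses the increasing pair i < i+1), so t̃ᵢ τ swaps the values of τ.
tt-preimage : Unique π → LeftOf (suc i) i π → s τ ≡ π → tt i τ ≡ map (swapVal i) τ
tt-preimage {i = i} {τ} uπ p refl = tt-leftOf uτ τ-order
  where
  d : StackSorts τ (s τ)
  d = s-stackSorts τ
  uτ : Unique τ
  uτ = unique-resp-↭ (stackSorts-↭ d) uπ
  in-τ : x ∈ s τ → x ∈ τ
  in-τ = Perm.∈-resp-↭ (stackSorts-↭ d)
  τ-order : LeftOf (suc i) i τ
  τ-order with leftOf-total (in-τ (lookup p (there (here refl)))) (in-τ (lookup p (here refl)))
                            (<⇒≢ (n<1+n i))
  ... | inj₁ i-first   = ⊥-elim (leftOf-asym uπ p (stackSorts-increasing d (n<1+n i) i-first))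
  ... | inj₂ i+1-first = i+1-first

tt-maps-preimages : Unique π → LeftOf (suc i) i π → s τ ≡ π → s (tt i τ) ≡ tt i π
tt-maps-preimages {π} {i} {τ} uπ p sτ = begin
  s (tt i τ)            ≡⟨ cong s (tt-preimage {τ = τ} uπ p sτ) ⟩
  s (map (swapVal i) τ) ≡⟨ s-swap {l = τ} sτ (leftOf-asym uπ p ∘ lowFactor-leftOf) ⟩
  map (swapVal i) π     ≡⟨ sym (tt-leftOf uπ p) ⟩
  tt i π                ∎
  where open ≡-Reasoning

tt-injective-on-preimages : Unique π → LeftOf (suc i) i π → s τ ≡ π → s τ′ ≡ π →
  tt i τ ≡ tt i τ′ → τ ≡ τ′
tt-injective-on-preimages {τ = τ} {τ′ = τ′} uπ p sτ sτ′ eq =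
  map-injective swap-injective
    (trans (sym (tt-preimage {τ = τ} uπ p sτ)) (trans eq (tt-preimage {τ = τ′} uπ p sτ′)))

tt-onto-preimages : Unique π → LeftOf (suc i) i π → Is231 (suc i) c i π →
  s σ ≡ tt i π → ∃ λ τ → s τ ≡ π × tt i τ ≡ σ
tt-onto-preimages {π} {i} {σ = σ} uπ p has231 sσ = map f σ , sτ , swap-back
  where
  f : ℕ → ℕ
  f = swapVal i
  sτ : s (map f σ) ≡ π
  sτ = trans (s-swap {l = σ} (trans sσ (tt-leftOf uπ p))
                     (no-lowFactor-over (UniqueP.map⁺ swap-injective uπ) (swap-231 has231)
                                        (proj₂ (proj₂ has231))))
             (map-swap-involutive i π)
  swap-back : tt i (map f σ) ≡ σ
  swap-back = trans (tt-preimage uπ p sτ) (map-swap-involutive i σ)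

lemma3p2 : (n : ℕ) (π : List ℕ) (i : ℕ) → IsPerm n π → 1 ≤ i → i < n →
    LeftOf (suc i) i π →
    ((τ : List ℕ) → IsPerm n τ → s τ ≡ π → s (tt i τ) ≡ tt i π)
    × ((τ τ′ : List ℕ) → IsPerm n τ → IsPerm n τ′ → s τ ≡ π → s τ′ ≡ π →
         tt i τ ≡ tt i τ′ → τ ≡ τ′)
    × ((∃ λ a → Is231 (suc i) a i π) →
         (σ : List ℕ) → IsPerm n σ → s σ ≡ tt i π →
         ∃ λ τ → IsPerm n τ × s τ ≡ π × tt i τ ≡ σ)
lemma3p2 n π i pπ _ _ p =
    (λ τ _ → tt-maps-preimages {τ = τ} uπ p)
  , (λ τ τ′ _ _ → tt-injective-on-preimages {τ = τ} {τ′ = τ′} uπ p)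
  , λ (_ , has231) σ _ sσ →
      let (τ , sτ , ttτ) = tt-onto-preimages {σ = σ} uπ p has231 sσ
      -- τ permutes its image s τ = π, hence is a permutation of [n]
      in τ , ↭-trans (↭-sym (subst (_↭ τ) sτ (s-↭ τ))) pπ , sτ , ttτ
  where
  uπ : Unique π
  uπ = perm-unique n pπ
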